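{- Let $n\geq 2$ and arrange $[n]=\{1,\ldots,n\}$ in the cyclic order $1,2,\ldots,n$ (elements taken mod $n$). Let $\hat{\mathcal{F}}$ be a family of intervals with respect to this cyclic order such that $\emptyset,[n]\notin\hat{\mathcal{F}}$ and $\hat{\mathcal{F}}$ contains no four distinct members $A,B,C,D$ with $A\cup B\subseteq C\cap D$. Then $|\hat{\mathcal{F}}|\leq 2n$.
   Context: An interval (with respect to the cyclic order $1,\ldots,n$ of $[n]$, elements taken mod $n$) is a subset of the form $\{k,k+1,\ldots,l\}$ with $1\leq k,l\leq n$. -}

module Defs where

open import Data.Nat using (ℕ; _+_; _∸_; _≤ᵇ_)
open import Data.Bool using (if_then_else_)
open import Data.Fin using (Fin; toℕ)
open import Data.Fin.Subset using (Subset; inside; outside)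
open import Data.Vec using (tabulate)
open import Data.Product using (∃₂)
open import Relation.Binary.PropositionalEquality using (_≡_)

-- Ground set [n] is modelled as Fin n (element j ↔ j+1), cyclic order 0,1,…,n-1.
-- cdist n k i : number of cyclic steps from k forward to i, in {0,…,n-1}.
cdist : (n : ℕ) → Fin n → Fin n → ℕ
cdist n k i = if toℕ k ≤ᵇ toℕ i then toℕ i ∸ toℕ k else (toℕ i + n) ∸ toℕ k

interval : (n : ℕ) → Fin n → Fin n → Subset n
interval n k l = tabulate (λ i → if cdist n k i ≤ᵇ cdist n k l then inside else outside)

IsInterval : (n : ℕ) → Subset n → Set
IsInterval n S = ∃₂ λ k l → S ≡ interval n k l

{-# OPTIONS --safe #-}
-- Encode an interval by its endpoints; a non-full interval determines them. Members sharing a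
-- start (or an end) are nested, ordered by length, so four of them would form a butterfly; and if
-- x ⊂ y ⊂ z share a start, y is the only member with its end: any other such u is nested with y,
-- giving the butterfly u, x ⊆ y, z or x, y ⊆ z, u. A member whose start is shared by a members
-- and whose end by b members charges weight a b to its start and weight b a to its end. These
-- add up to at least 2, while by the above every start, and symmetrically every end, collects
-- at most 2; hence 2 |F| ≤ 4 n.
module Submission where

open import Defs
open import Data.Bool using (Bool; true; false; T; if_then_else_)
open import Data.Empty using (⊥-elim)
open import Data.Fin using (Fin; zero; suc; toℕ)
open import Data.Fin.Properties using (toℕ<n; toℕ-injective; ¬∀⟶∃¬) renaming (_≟_ to _≟ᶠ_)
open import Data.Fin.Subset using (Subset; _⊆_; _∪_; _∩_; ⊥; ⊤; inside; outside)
  renaming (_∈_ to _∈ₛ_; _∉_ to _∉ₛ_)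
open import Data.Fin.Subset.Properties using (_∈?_; ⊆-antisym; ⊆⊤; x∈p∩q⁺; x∈p∪q⁻)
open import Data.List using (List; []; _∷_; length; map; filter)
open import Data.List.Membership.Propositional using (_∈_; _∉_)
open import Data.List.Membership.Propositional.Properties using (∈-map⁺; ∈-filter⁺; ∈-filter⁻)
open import Data.List.Properties using (length-map)
open import Data.List.Relation.Unary.All using (All; []; _∷_)
open import Data.List.Relation.Unary.AllPairs using ([]; _∷_)
open import Data.List.Relation.Unary.Any using (here; there)
open import Data.List.Relation.Unary.Unique.Propositional using (Unique)
open import Data.List.Relation.Unary.Unique.Propositional.Properties using (map⁻; filter⁺)
open import Data.Nat using (ℕ; zero; suc; _+_; _*_; _≤_; _<_; _≤ᵇ_; z≤n; s≤s)
open import Data.Nat.ListAction using (sum)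
open import Data.Nat.Properties hiding (_≟_)
open import Algebra.Properties.CommutativeMonoid.Sum +-0-commutativeMonoid
  using (∑-distrib-+; sum-cong-≗; sum-replicate-zero) renaming (sum to ∑)
open import Data.Nat.Solver using (module +-*-Solver)
open import Algebra.Properties.CommutativeSemigroup +-commutativeSemigroup using (interchange)
open import Data.Product using (_×_; _,_; proj₁; proj₂; ∃-syntax; uncurry)
open import Data.Product.Properties using (≡-dec; ×-≡,≡→≡)
open import Data.Sum as Sum using (_⊎_; inj₁; inj₂; [_,_]′)
open import Data.Unit using (tt)
open import Data.Vec.Properties using (lookup∘tabulate; []=⇒lookup; lookup⇒[]=)
open import Function using (_∘_)
open import Relation.Binary.Definitions using (DecidableEquality; Transitive; tri<; tri≈; tri>)
open import Relation.Binary.PropositionalEquality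
  using (_≡_; _≢_; refl; sym; trans; cong; cong₂; subst; ≢-sym; module ≡-Reasoning)
open import Relation.Nullary using (¬_; yes; no; does)

private
  variable
    n : ℕ

-- Cyclic distance and cyclic intervals

+-cancel-wraps : ∀ {d₁ d₂ d₃ a b c x y z w : ℕ} →
  d₁ + a ≡ b + x → d₂ + b ≡ c + y → d₃ + a ≡ c + z → x + y ≡ z + w → d₁ + d₂ ≡ d₃ + w
+-cancel-wraps {d₁} {d₂} {d₃} {a} {b} {c} {x} {y} {z} {w} e₁ e₂ e₃ e₄ = +-cancelʳ-≡ (a + b) _ _ (begin
  (d₁ + d₂) + (a + b) ≡⟨ interchange d₁ d₂ a b ⟩
  (d₁ + a) + (d₂ + b) ≡⟨ cong₂ _+_ e₁ e₂ ⟩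
  (b + x) + (c + y)   ≡⟨ interchange b x c y ⟩
  (b + c) + (x + y)   ≡⟨ cong (b + c +_) e₄ ⟩
  (b + c) + (z + w)   ≡⟨ solve 4 (λ b c z w → (b :+ c) :+ (z :+ w) := (c :+ z) :+ (w :+ b)) refl b c z w ⟩
  (c + z) + (w + b)   ≡⟨ cong (_+ (w + b)) e₃ ⟨
  (d₃ + a) + (w + b)  ≡⟨ interchange d₃ a w b ⟩
  (d₃ + w) + (a + b)  ∎)
  where
  open ≡-Reasoning
  open +-*-Solver

-- The first case carries a + 0 so that both cases have the shape expected by +-cancel-wraps.
CdistCases : (n : ℕ) → Fin n → Fin n → Set
CdistCases n k i =
  (toℕ k ≤ toℕ i × cdist n k i + toℕ k ≡ toℕ i + 0) ⊎
  (toℕ i < toℕ k × cdist n k i + toℕ k ≡ toℕ i + n)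

cdist-cases : (k i : Fin n) → CdistCases n k i
cdist-cases {n} k i with toℕ k ≤ᵇ toℕ i in eq
... | true  = inj₁ (k≤i , trans (m∸n+n≡m k≤i) (sym (+-identityʳ _)))
  where k≤i = ≤ᵇ⇒≤ _ _ (subst T (sym eq) tt)
... | false = inj₂ (i<k , m∸n+n≡m (≤-trans (<⇒≤ (toℕ<n k)) (m≤n+m n (toℕ i))))
  where i<k = ≰⇒> (λ k≤i → subst T eq (≤⇒≤ᵇ k≤i))

cdist<n : (k i : Fin n) → cdist n k i < n
cdist<n {n} k i with cdist-cases k i
... | inj₁ (_ , e)   = ≤-<-trans (m+n≤o⇒m≤o _ (≤-reflexive (trans e (+-identityʳ _)))) (toℕ<n i)
... | inj₂ (i<k , e) = +-cancelʳ-< (toℕ k) _ n (begin-strict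
  cdist n k i + toℕ k ≡⟨ e ⟩
  toℕ i + n           <⟨ +-monoˡ-< n i<k ⟩
  toℕ k + n           ≡⟨ +-comm (toℕ k) n ⟩
  n + toℕ k           ∎)
  where open ≤-Reasoning

cdist-self : (k : Fin n) → cdist n k k ≡ 0
cdist-self k with cdist-cases k k
... | inj₁ (_ , e)   = +-cancelʳ-≡ (toℕ k) _ 0 (trans e (+-identityʳ _))
... | inj₂ (k<k , _) = ⊥-elim (<-irrefl refl k<k)

cdist≡0⇒≡ : {k i : Fin n} → cdist n k i ≡ 0 → k ≡ i
cdist≡0⇒≡ {n} {k} {i} d≡0 with cdist-cases k i
... | inj₁ (_ , e) = toℕ-injective (trans (cong (_+ toℕ k) (sym d≡0)) (trans e (+-identityʳ _)))
... | inj₂ (_ , e) = ⊥-elim (<-irrefl refl (<-≤-trans (toℕ<n k) (begin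
  n                   ≤⟨ m≤n+m n (toℕ i) ⟩
  toℕ i + n           ≡⟨ e ⟨
  cdist n k i + toℕ k ≡⟨ cong (_+ toℕ k) d≡0 ⟩
  toℕ k               ∎)))
  where open ≤-Reasoning

cdist-triangle : (x y z : Fin n) →
  cdist n x y + cdist n y z ≡ cdist n x z ⊎ cdist n x y + cdist n y z ≡ cdist n x z + n
cdist-triangle {n} x y z = by-cases (cdist-cases x y) (cdist-cases y z) (cdist-cases x z)
  where
  wraps : ∀ {p q r w} → cdist n x y + toℕ x ≡ toℕ y + p → cdist n y z + toℕ y ≡ toℕ z + q →
    cdist n x z + toℕ x ≡ toℕ z + r → p + q ≡ r + w → cdist n x y + cdist n y z ≡ cdist n x z + w
  wraps = +-cancel-wraps {cdist n x y} {cdist n y z} {cdist n x z} {toℕ x} {toℕ y} {toℕ z}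
  by-cases : CdistCases n x y → CdistCases n y z → CdistCases n x z →
    cdist n x y + cdist n y z ≡ cdist n x z ⊎ cdist n x y + cdist n y z ≡ cdist n x z + n
  by-cases (inj₁ (_ , e₁))  (inj₁ (_ , e₂))  (inj₁ (_ , e₃))  = inj₁ (trans (wraps e₁ e₂ e₃ refl) (+-identityʳ _))
  by-cases (inj₁ (x≤y , _)) (inj₁ (y≤z , _)) (inj₂ (z<x , _)) = ⊥-elim (<⇒≱ z<x (≤-trans x≤y y≤z))
  by-cases (inj₁ (_ , e₁))  (inj₂ (_ , e₂))  (inj₁ (_ , e₃))  = inj₂ (wraps e₁ e₂ e₃ refl)
  by-cases (inj₁ (_ , e₁))  (inj₂ (_ , e₂))  (inj₂ (_ , e₃))  =
    inj₁ (trans (wraps e₁ e₂ e₃ (sym (+-identityʳ n))) (+-identityʳ _))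
  by-cases (inj₂ (_ , e₁))  (inj₁ (_ , e₂))  (inj₁ (_ , e₃))  = inj₂ (wraps e₁ e₂ e₃ (+-identityʳ n))
  by-cases (inj₂ (_ , e₁))  (inj₁ (_ , e₂))  (inj₂ (_ , e₃))  = inj₁ (trans (wraps e₁ e₂ e₃ refl) (+-identityʳ _))
  by-cases (inj₂ (y<x , _)) (inj₂ (z<y , _)) (inj₁ (x≤z , _)) = ⊥-elim (<⇒≱ (<-trans z<y y<x) x≤z)
  by-cases (inj₂ (_ , e₁))  (inj₂ (_ , e₂))  (inj₂ (_ , e₃))  = inj₂ (wraps e₁ e₂ e₃ refl)

cdist-splitˡ : (k i l : Fin n) → cdist n k i ≤ cdist n k l → cdist n k i + cdist n i l ≡ cdist n k l
cdist-splitˡ k i l ki≤kl with cdist-triangle k i l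
... | inj₁ e = e
... | inj₂ e = ⊥-elim (<-irrefl e (+-mono-≤-< ki≤kl (cdist<n i l)))

cdist-splitʳ : (k i l : Fin n) → cdist n i l ≤ cdist n k l → cdist n k i + cdist n i l ≡ cdist n k l
cdist-splitʳ {n} k i l il≤kl with cdist-triangle k i l
... | inj₁ e = e
... | inj₂ e = ⊥-elim (<-irrefl (trans e (+-comm _ n)) (+-mono-<-≤ (cdist<n k i) il≤kl))

cdist-injectiveʳ : (k : Fin n) {l l′ : Fin n} → cdist n k l ≡ cdist n k l′ → l ≡ l′
cdist-injectiveʳ {n} k {l} {l′} e = cdist≡0⇒≡ (+-cancelˡ-≡ (cdist n k l) _ 0 (begin
  cdist n k l + cdist n l l′ ≡⟨ cdist-splitˡ k l l′ (≤-reflexive e) ⟩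
  cdist n k l′               ≡⟨ e ⟨
  cdist n k l                ≡⟨ +-identityʳ _ ⟨
  cdist n k l + 0            ∎))
  where open ≡-Reasoning

cdist-injectiveˡ : (l : Fin n) {k k′ : Fin n} → cdist n k l ≡ cdist n k′ l → k ≡ k′
cdist-injectiveˡ {n} l {k} {k′} e = cdist≡0⇒≡ (+-cancelʳ-≡ (cdist n k′ l) _ 0
  (trans (cdist-splitʳ k k′ l (≤-reflexive (sym e))) e))

cdist-round-trip : {k k′ : Fin n} → k ≢ k′ → cdist n k k′ + cdist n k′ k ≡ n
cdist-round-trip {n} {k} {k′} k≢k′ with cdist-triangle k k′ k
... | inj₁ e = ⊥-elim (k≢k′ (cdist≡0⇒≡ (m+n≡0⇒m≡0 _ (trans e (cdist-self k)))))
... | inj₂ e = trans e (cong (_+ n) (cdist-self k))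

private
  if-inside⁺ : {b : Bool} → T b → (if b then inside else outside) ≡ inside
  if-inside⁺ {true} _ = refl

  if-inside⁻ : {b : Bool} → (if b then inside else outside) ≡ inside → T b
  if-inside⁻ {true} _ = tt

∈-interval⁺ : (k l : Fin n) {i : Fin n} → cdist n k i ≤ cdist n k l → i ∈ₛ interval n k l
∈-interval⁺ k l {i} ki≤kl = lookup⇒[]= i _ (trans (lookup∘tabulate _ i) (if-inside⁺ (≤⇒≤ᵇ ki≤kl)))

∈-interval⁻ : (k l : Fin n) {i : Fin n} → i ∈ₛ interval n k l → cdist n k i ≤ cdist n k l
∈-interval⁻ k l {i} i∈ = ≤ᵇ⇒≤ _ _ (if-inside⁻ (trans (sym (lookup∘tabulate _ i)) ([]=⇒lookup i∈)))

∈-interval-fromEnd⁺ : (k l : Fin n) {i : Fin n} → cdist n i l ≤ cdist n k l → i ∈ₛ interval n k l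
∈-interval-fromEnd⁺ k l {i} il≤kl =
  ∈-interval⁺ k l (subst (cdist _ k i ≤_) (cdist-splitʳ k i l il≤kl) (m≤m+n _ _))

∈-interval-fromEnd⁻ : (k l : Fin n) {i : Fin n} → i ∈ₛ interval n k l → cdist n i l ≤ cdist n k l
∈-interval-fromEnd⁻ k l {i} i∈ =
  subst (cdist _ i l ≤_) (cdist-splitˡ k i l (∈-interval⁻ k l i∈)) (m≤n+m _ _)

start∈interval : (k l : Fin n) → k ∈ₛ interval n k l
start∈interval k l = ∈-interval⁺ k l (subst (_≤ cdist _ k l) (sym (cdist-self k)) z≤n)

end∈interval : (k l : Fin n) → l ∈ₛ interval n k l
end∈interval k l = ∈-interval⁺ k l ≤-refl

interval-⊆-sameStart : (k l l′ : Fin n) → cdist n k l ≤ cdist n k l′ → interval n k l ⊆ interval n k l′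
interval-⊆-sameStart k l l′ kl≤kl′ i∈ = ∈-interval⁺ k l′ (≤-trans (∈-interval⁻ k l i∈) kl≤kl′)

interval-⊆-sameEnd : (k k′ l : Fin n) → cdist n k l ≤ cdist n k′ l → interval n k l ⊆ interval n k′ l
interval-⊆-sameEnd k k′ l kl≤k′l i∈ = ∈-interval-fromEnd⁺ k′ l (≤-trans (∈-interval-fromEnd⁻ k l i∈) kl≤k′l)

≢⊤⇒∃∉ : {p : Subset n} → p ≢ ⊤ → ∃[ j ] j ∉ₛ p
≢⊤⇒∃∉ {n} {p} p≢⊤ = ¬∀⟶∃¬ n (_∈ₛ p) (_∈? p) (λ ∀∈ → p≢⊤ (⊆-antisym ⊆⊤ (λ {j} _ → ∀∈ j)))

-- Two intervals with different starts, each containing the other's start, cover the whole circle.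
interval-start-unique : {k l k′ l′ j : Fin n} → j ∉ₛ interval n k l →
  interval n k l ≡ interval n k′ l′ → k ≡ k′
interval-start-unique {n} {k} {l} {k′} {l′} {j} j∉ eq with k ≟ᶠ k′
... | yes k≡k′ = k≡k′
... | no  k≢k′ = ⊥-elim (j∉ (subst (j ∈ₛ_) (sym eq) (∈-interval⁺ k′ l′ j-near-k′)))
  where
  k′-near-k : cdist n k k′ ≤ cdist n k l
  k′-near-k = ∈-interval⁻ k l (subst (k′ ∈ₛ_) (sym eq) (start∈interval k′ l′))
  k-near-k′ : cdist n k′ k ≤ cdist n k′ l′
  k-near-k′ = ∈-interval⁻ k′ l′ (subst (k ∈ₛ_) eq (start∈interval k l))
  j-far-from-k : cdist n k l < cdist n k j
  j-far-from-k = ≰⇒> (j∉ ∘ ∈-interval⁺ k l)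
  j-near-k′ : cdist n k′ j ≤ cdist n k′ l′
  j-near-k′ = ≤-trans (<⇒≤ (+-cancelˡ-< (cdist n k k′) _ _ (begin-strict
    cdist n k k′ + cdist n k′ j ≡⟨ cdist-splitˡ k k′ j (≤-trans k′-near-k (<⇒≤ j-far-from-k)) ⟩
    cdist n k j                 <⟨ cdist<n k j ⟩
    n                           ≡⟨ cdist-round-trip k≢k′ ⟨
    cdist n k k′ + cdist n k′ k ∎))) k-near-k′
    where open ≤-Reasoning

interval-injective : {k l k′ l′ : Fin n} → interval n k l ≢ ⊤ →
  interval n k l ≡ interval n k′ l′ → k ≡ k′ × l ≡ l′
interval-injective {k = k} {l} {k′} {l′} ≢⊤ eq
  with interval-start-unique {k = k} {l} {k′} {l′} (proj₂ (≢⊤⇒∃∉ ≢⊤)) eq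
... | refl = refl , cdist-injectiveʳ k (≤-antisym
  (∈-interval⁻ k l′ (subst (l ∈ₛ_) eq (end∈interval k l)))
  (∈-interval⁻ k l (subst (l′ ∈ₛ_) (sym eq) (end∈interval k l′))))

private
  variable
    A : Set

length-≡1 : {xs : List A} {y : A} → Unique xs → y ∈ xs → (∀ {x} → x ∈ xs → x ≡ y) → length xs ≡ 1
length-≡1 {xs = _ ∷ []}     _                    _ _    = refl
length-≡1 {xs = _ ∷ _ ∷ _} ((x≢x′ ∷ _) ∷ _) _ all≡y =
  ⊥-elim (x≢x′ (trans (all≡y (here refl)) (sym (all≡y (there (here refl))))))

sum-≤-length : {f : A → ℕ} (xs : List A) → (∀ {x} → x ∈ xs → f x ≤ 1) → sum (map f xs) ≤ length xs
sum-≤-length []       _   = z≤n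
sum-≤-length (x ∷ xs) f≤1 = +-mono-≤ (f≤1 (here refl)) (sum-≤-length xs (f≤1 ∘ there))

sum-<-length : {f : A → ℕ} {y : A} (xs : List A) → (∀ {x} → x ∈ xs → f x ≤ 1) → y ∈ xs → f y ≡ 0 →
  sum (map f xs) < length xs
sum-<-length (x ∷ xs) f≤1 (here refl) fx≡0 =
  ≤-<-trans (+-mono-≤ (≤-reflexive fx≡0) (sum-≤-length xs (f≤1 ∘ there))) (n<1+n _)
sum-<-length (x ∷ xs) f≤1 (there y∈) fy≡0 =
  +-mono-≤-< (f≤1 (here refl)) (sum-<-length xs (f≤1 ∘ there) y∈ fy≡0)

c*length≤sum+sum : (f g : A → ℕ) {c : ℕ} → (∀ x → c ≤ f x + g x) → (xs : List A) →
  c * length xs ≤ sum (map f xs) + sum (map g xs)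
c*length≤sum+sum f g {c} _  []       = ≤-reflexive (*-zeroʳ c)
c*length≤sum+sum f g {c} c≤ (x ∷ xs) = begin
  c * suc (length xs)                         ≡⟨ *-suc c (length xs) ⟩
  c + c * length xs                           ≤⟨ +-mono-≤ (c≤ x) (c*length≤sum+sum f g c≤ xs) ⟩
  (f x + g x) + (sum (map f xs) + sum (map g xs)) ≡⟨ interchange (f x) (g x) _ _ ⟩
  (f x + sum (map f xs)) + (g x + sum (map g xs)) ∎
  where open ≤-Reasoning

sort-three : (f : A → ℕ) (Q : A → Set) {p q r : A} → Q p → Q q → Q r →
  f p ≢ f q → f p ≢ f r → f q ≢ f r → ∃[ x ] ∃[ y ] ∃[ z ] (Q x × Q y × Q z × f x < f y × f y < f z)
sort-three f Q {p} {q} {r} Qp Qq Qr p≢q p≢r q≢r with <-cmp (f p) (f q) | <-cmp (f q) (f r) | <-cmp (f p) (f r)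
... | tri≈ _ p≡q _ | _            | _            = ⊥-elim (p≢q p≡q)
... | _            | tri≈ _ q≡r _ | _            = ⊥-elim (q≢r q≡r)
... | _            | _            | tri≈ _ p≡r _ = ⊥-elim (p≢r p≡r)
... | tri< p<q _ _ | tri< q<r _ _ | _            = p , q , r , Qp , Qq , Qr , p<q , q<r
... | tri< _ _ _   | tri> _ _ r<q | tri< p<r _ _ = p , r , q , Qp , Qr , Qq , p<r , r<q
... | tri< p<q _ _ | tri> _ _ _   | tri> _ _ r<p = r , p , q , Qr , Qp , Qq , r<p , p<q
... | tri> _ _ q<p | tri< _ _ _   | tri< p<r _ _ = q , p , r , Qq , Qp , Qr , q<p , p<r
... | tri> _ _ _   | tri< q<r _ _ | tri> _ _ r<p = q , r , p , Qq , Qr , Qp , q<r , r<p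
... | tri> _ _ q<p | tri> _ _ r<q | _            = r , q , p , Qr , Qq , Qp , r<q , q<p

∑-indicator : {m : ℕ} (j : Fin m) (c : ℕ) → ∑ (λ k → if does (j ≟ᶠ k) then c else 0) ≡ c
∑-indicator {suc m} zero    c = trans (cong (c +_) (sum-replicate-zero m)) (+-identityʳ c)
∑-indicator {suc m} (suc j) c = ∑-indicator j c

∑-mono-≤ : {m : ℕ} {f g : Fin m → ℕ} → (∀ k → f k ≤ g k) → ∑ f ≤ ∑ g
∑-mono-≤ {zero}  _   = z≤n
∑-mono-≤ {suc m} f≤g = +-mono-≤ (f≤g zero) (∑-mono-≤ (f≤g ∘ suc))

∑-const : (m c : ℕ) → ∑ {m} (λ _ → c) ≡ m * c
∑-const zero    c = refl
∑-const (suc m) c = cong (c +_) (∑-const m c)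

keyClass : {m : ℕ} → (A → Fin m) → List A → Fin m → List A
keyClass key xs k = filter (λ x → key x ≟ᶠ k) xs

module _ {m : ℕ} (key : A → Fin m) (f : A → ℕ) where

  sum-keyClass-∷ : (x : A) (xs : List A) (k : Fin m) →
    sum (map f (keyClass key (x ∷ xs) k)) ≡
    (if does (key x ≟ᶠ k) then f x else 0) + sum (map f (keyClass key xs k))
  sum-keyClass-∷ x xs k with key x ≟ᶠ k
  ... | yes _ = refl
  ... | no  _ = refl

  sum-by-keyClasses : (xs : List A) → sum (map f xs) ≡ ∑ (λ k → sum (map f (keyClass key xs k)))
  sum-by-keyClasses []       = sym (sum-replicate-zero m)
  sum-by-keyClasses (x ∷ xs) = begin
    f x + sum (map f xs)
      ≡⟨ cong₂ _+_ (sym (∑-indicator (key x) (f x))) (sum-by-keyClasses xs) ⟩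
    ∑ (λ k → if does (key x ≟ᶠ k) then f x else 0) + ∑ (λ k → sum (map f (keyClass key xs k)))
      ≡⟨ ∑-distrib-+ {m} _ _ ⟨
    ∑ (λ k → (if does (key x ≟ᶠ k) then f x else 0) + sum (map f (keyClass key xs k)))
      ≡⟨ sum-cong-≗ (λ k → sym (sum-keyClass-∷ x xs k)) ⟩
    ∑ (λ k → sum (map f (keyClass key (x ∷ xs) k))) ∎
    where open ≡-Reasoning

  sum-≤-by-keyClasses : (xs : List A) {c : ℕ} → (∀ k → sum (map f (keyClass key xs k)) ≤ c) →
    sum (map f xs) ≤ m * c
  sum-≤-by-keyClasses xs {c} class≤c = begin
    sum (map f xs)                            ≡⟨ sum-by-keyClasses xs ⟩
    ∑ (λ k → sum (map f (keyClass key xs k))) ≤⟨ ∑-mono-≤ class≤c ⟩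
    ∑ {m} (λ _ → c)                           ≡⟨ ∑-const m c ⟩
    m * c                                     ∎
    where open ≤-Reasoning

-- Butterfly-free interval systems

ButterflyFree : {P : Set} → (P → P → Set) → List P → Set
ButterflyFree _⊑_ G = ∀ {a b c d} → a ∈ G → b ∈ G → c ∈ G → d ∈ G →
  a ≢ b → a ≢ c → a ≢ d → b ≢ c → b ≢ d → c ≢ d → ¬ (a ⊑ c × a ⊑ d × b ⊑ c × b ⊑ d)

record IntervalSystem (P : Set) (m : ℕ) : Set₁ where
  field
    _≟_                  : DecidableEquality P
    start end            : P → Fin m
    size                 : P → ℕ
    _⊑_                  : P → P → Set
    ⊑-trans              : Transitive _⊑_
    ⊑-start              : ∀ {x y} → start x ≡ start y → size x ≤ size y → x ⊑ y
    ⊑-end                : ∀ {x y} → end x ≡ end y → size x ≤ size y → x ⊑ y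
    size-injective-start : ∀ {x y} → start x ≡ start y → size x ≡ size y → x ≡ y
    size-injective-end   : ∀ {x y} → end x ≡ end y → size x ≡ size y → x ≡ y
    endpoints-injective  : ∀ {x y} → start x ≡ start y → end x ≡ end y → x ≡ y

reverse : {P : Set} {m : ℕ} → IntervalSystem P m → IntervalSystem P m
reverse S = record
  { _≟_                  = _≟_
  ; start                = end
  ; end                  = start
  ; size                 = size
  ; _⊑_                  = _⊑_
  ; ⊑-trans              = ⊑-trans
  ; ⊑-start              = ⊑-end
  ; ⊑-end                = ⊑-start
  ; size-injective-start = size-injective-end
  ; size-injective-end   = size-injective-start
  ; endpoints-injective  = λ e₁ e₂ → endpoints-injective e₂ e₁
  }
  where open IntervalSystem S

weight : ℕ → ℕ → ℕ
weight 1 _ = 2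
weight _ 1 = 0
weight _ _ = 1

weight-2+≤1 : (a b : ℕ) → weight (2 + a) b ≤ 1
weight-2+≤1 a zero          = ≤-refl
weight-2+≤1 a 1             = z≤n
weight-2+≤1 a (suc (suc b)) = ≤-refl

weight≤2 : (a b : ℕ) → weight a b ≤ 2
weight≤2 zero          zero          = s≤s z≤n
weight≤2 zero          1             = z≤n
weight≤2 zero          (suc (suc b)) = s≤s z≤n
weight≤2 1             b             = ≤-refl
weight≤2 (suc (suc a)) b             = ≤-trans (weight-2+≤1 a b) (s≤s z≤n)

weight+weight-swap≥2 : (a b : ℕ) → 2 ≤ weight a b + weight b a
weight+weight-swap≥2 1             b             = m≤m+n 2 _
weight+weight-swap≥2 zero          1             = ≤-refl
weight+weight-swap≥2 (suc (suc a)) 1             = ≤-refl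
weight+weight-swap≥2 zero          zero          = ≤-refl
weight+weight-swap≥2 zero          (suc (suc b)) = ≤-refl
weight+weight-swap≥2 (suc (suc a)) zero          = ≤-refl
weight+weight-swap≥2 (suc (suc a)) (suc (suc b)) = ≤-refl

module Charging {P : Set} {m : ℕ} (S : IntervalSystem P m) (G : List P) (G-unique : Unique G)
  (G-butterfly-free : ButterflyFree (IntervalSystem._⊑_ S) G) where

  open IntervalSystem S

  private
    variable
      k : Fin m
      x y z u : P

  startDegree endDegree : P → ℕ
  startDegree x = length (keyClass start G (start x))
  endDegree   x = length (keyClass end G (end x))

  charge : P → ℕ
  charge x = weight (startDegree x) (endDegree x)

  InClass : Fin m → P → Set
  InClass k x = x ∈ G × start x ≡ k

  Chain : Fin m → P → P → P → Set
  Chain k x y z = InClass k x × InClass k y × InClass k z × size x < size y × size y < size z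

  size-<⇒≢ : size x < size y → x ≢ y
  size-<⇒≢ x<y x≡y = <-irrefl (cong size x≡y) x<y

  size-≢-inClass : InClass k x → InClass k y → x ≢ y → size x ≢ size y
  size-≢-inClass (_ , kx) (_ , ky) x≢y = x≢y ∘ size-injective-start (trans kx (sym ky))

  comparable-start : start x ≡ start y → x ⊑ y ⊎ y ⊑ x
  comparable-start {x} {y} e = Sum.map (⊑-start e) (⊑-start (sym e)) (≤-total (size x) (size y))

  comparable-end : end x ≡ end y → x ⊑ y ⊎ y ⊑ x
  comparable-end {x} {y} e = Sum.map (⊑-end e) (⊑-end (sym e)) (≤-total (size x) (size y))

  chain-excludes-comparable : Chain k x y z → u ∈ G → u ≢ x → u ≢ y → u ≢ z → ¬ (u ⊑ y ⊎ y ⊑ u)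
  chain-excludes-comparable {y = y} {u = u} ((xG , kx) , (yG , ky) , (zG , kz) , x<y , y<z) uG u≢x u≢y u≢z =
    [ below , above ]′
    where
    x⊑y = ⊑-start (trans kx (sym ky)) (<⇒≤ x<y)
    y⊑z = ⊑-start (trans ky (sym kz)) (<⇒≤ y<z)
    x≢y = size-<⇒≢ x<y
    y≢z = size-<⇒≢ y<z
    x≢z = size-<⇒≢ (<-trans x<y y<z)
    below : ¬ u ⊑ y
    below u⊑y = G-butterfly-free uG xG yG zG u≢x u≢y u≢z x≢y x≢z y≢z
      (u⊑y , ⊑-trans u⊑y y⊑z , x⊑y , ⊑-trans x⊑y y⊑z)
    above : ¬ y ⊑ u
    above y⊑u = G-butterfly-free xG yG zG uG x≢y x≢z (≢-sym u≢x) y≢z (≢-sym u≢y) (≢-sym u≢z)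
      (⊑-trans x⊑y y⊑z , ⊑-trans x⊑y y⊑u , y⊑z , y⊑u)

  chain-middle-endDegree : Chain k x y z → endDegree y ≡ 1
  chain-middle-endDegree {x = x} {y} {z} ch@((_ , kx) , (yG , ky) , (_ , kz) , x<y , y<z) =
    length-≡1 (filter⁺ (λ v → end v ≟ᶠ end y) G-unique) (∈-filter⁺ (λ v → end v ≟ᶠ end y) yG refl) only-y
    where
    only-y : ∀ {u} → u ∈ keyClass end G (end y) → u ≡ y
    only-y {u} u∈ with ∈-filter⁻ (λ v → end v ≟ᶠ end y) {xs = G} u∈ | u ≟ y
    ... | _         | yes u≡y = u≡y
    ... | uG , eu≡ey | no u≢y  = ⊥-elim (chain-excludes-comparable ch uG u≢x u≢y u≢z (comparable-end eu≡ey))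
      where
      u≢x : u ≢ x
      u≢x u≡x = size-<⇒≢ x<y (endpoints-injective (trans kx (sym ky)) (trans (cong end (sym u≡x)) eu≡ey))
      u≢z : u ≢ z
      u≢z u≡z = size-<⇒≢ y<z (sym (endpoints-injective (trans kz (sym ky)) (trans (cong end (sym u≡z)) eu≡ey)))

  charge≤1 : ∀ {a} → startDegree x ≡ 2 + a → charge x ≤ 1
  charge≤1 {x} e = subst (λ d → weight d (endDegree x) ≤ 1) (sym e) (weight-2+≤1 _ _)

  charge≡0 : ∀ {a} → startDegree x ≡ 2 + a → endDegree x ≡ 1 → charge x ≡ 0
  charge≡0 e e′ = cong₂ weight e e′

  charge-sum≤2 : (H : List P) → Unique H → (∀ {x} → x ∈ H → InClass k x) →
    (∀ {x} → x ∈ H → startDegree x ≡ length H) → sum (map charge H) ≤ 2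
  charge-sum≤2 [] _ _ _ = z≤n
  charge-sum≤2 (p ∷ []) _ _ _ = subst (_≤ 2) (sym (+-identityʳ (charge p))) (weight≤2 _ _)
  charge-sum≤2 H@(_ ∷ _ ∷ []) _ _ deg = sum-≤-length H (charge≤1 ∘ deg)
  charge-sum≤2 H@(p ∷ q ∷ r ∷ []) ((p≢q ∷ p≢r ∷ []) ∷ (q≢r ∷ []) ∷ [] ∷ []) cls deg
    with sort-three size (_∈ H) (here refl) (there (here refl)) (there (there (here refl)))
           (size-≢-inClass (cls (here refl)) (cls (there (here refl))) p≢q)
           (size-≢-inClass (cls (here refl)) (cls (there (there (here refl)))) p≢r)
           (size-≢-inClass (cls (there (here refl))) (cls (there (there (here refl)))) q≢r)
  ... | _ , y , _ , x∈ , y∈ , z∈ , x<y , y<z = ≤-pred (sum-<-length H (charge≤1 ∘ deg) y∈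
          (charge≡0 (deg y∈) (chain-middle-endDegree (cls x∈ , cls y∈ , cls z∈ , x<y , y<z))))
  charge-sum≤2 (p ∷ q ∷ r ∷ s ∷ _) ((p≢q ∷ p≢r ∷ p≢s ∷ _) ∷ (q≢r ∷ q≢s ∷ _) ∷ (r≢s ∷ _) ∷ _) cls _
    with sort-three size (λ t → InClass _ t × s ≢ t)
           (cls (here refl) , ≢-sym p≢s) (cls (there (here refl)) , ≢-sym q≢s)
           (cls (there (there (here refl))) , ≢-sym r≢s)
           (size-≢-inClass (cls (here refl)) (cls (there (here refl))) p≢q)
           (size-≢-inClass (cls (here refl)) (cls (there (there (here refl)))) p≢r)
           (size-≢-inClass (cls (there (here refl))) (cls (there (there (here refl)))) q≢r)
  ... | _ , _ , _ , (x∈ , s≢x) , (y∈ , s≢y) , (z∈ , s≢z) , x<y , y<z =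
    ⊥-elim (chain-excludes-comparable (x∈ , y∈ , z∈ , x<y , y<z) (proj₁ s∈) s≢x s≢y s≢z
      (comparable-start (trans (proj₂ s∈) (sym (proj₂ y∈)))))
    where s∈ = cls (there (there (there (here refl))))

  keyClass-charge-sum≤2 : ∀ k → sum (map charge (keyClass start G k)) ≤ 2
  keyClass-charge-sum≤2 k = charge-sum≤2 (keyClass start G k) (filter⁺ (λ x → start x ≟ᶠ k) G-unique)
    (∈-filter⁻ (λ x → start x ≟ᶠ k) {xs = G})
    (λ x∈ → cong (length ∘ keyClass start G) (proj₂ (∈-filter⁻ (λ x → start x ≟ᶠ k) {xs = G} x∈)))

  charge-total : sum (map charge G) ≤ m * 2
  charge-total = sum-≤-by-keyClasses start charge G keyClass-charge-sum≤2

butterfly-free-length : {P : Set} {m : ℕ} (S : IntervalSystem P m) (G : List P) → Unique G →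
  ButterflyFree (IntervalSystem._⊑_ S) G → length G ≤ 2 * m
butterfly-free-length {m = m} S G G-unique G-butterfly-free = *-cancelˡ-≤ 2 (begin
  2 * length G
    ≤⟨ c*length≤sum+sum charge charge′ (λ x → weight+weight-swap≥2 (startDegree x) (endDegree x)) G ⟩
  sum (map charge G) + sum (map charge′ G)
    ≤⟨ +-mono-≤ charge-total charge′-total ⟩
  m * 2 + m * 2
    ≡⟨ solve 1 (λ m → m :* con 2 :+ m :* con 2 := con 2 :* (con 2 :* m)) refl m ⟩
  2 * (2 * m) ∎)
  where
  open ≤-Reasoning
  open +-*-Solver
  open Charging S G G-unique G-butterfly-free
  open Charging (reverse S) G G-unique G-butterfly-free
    using () renaming (charge to charge′; charge-total to charge′-total)

-- Cyclic intervals as an interval system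

arc : Fin n × Fin n → Subset n
arc (k , l) = interval _ k l

intervalSystem : (n : ℕ) → IntervalSystem (Fin n × Fin n) n
intervalSystem n = record
  { _≟_                  = ≡-dec _≟ᶠ_ _≟ᶠ_
  ; start                = proj₁
  ; end                  = proj₂
  ; size                 = uncurry (cdist n)
  ; _⊑_                  = λ p q → arc p ⊆ arc q
  ; ⊑-trans              = λ p⊆q q⊆r → q⊆r ∘ p⊆q
  ; ⊑-start              = λ { {k , l} {_ , l′} refl → interval-⊆-sameStart k l l′ }
  ; ⊑-end                = λ { {k , l} {k′ , _} refl → interval-⊆-sameEnd k k′ l }
  ; size-injective-start = λ { {k , _} {_ , _} refl e → cong (k ,_) (cdist-injectiveʳ k e) }
  ; size-injective-end   = λ { {_ , l} {_ , _} refl e → cong (_, l) (cdist-injectiveˡ l e) }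
  ; endpoints-injective  = λ e₁ e₂ → ×-≡,≡→≡ (e₁ , e₂)
  }

endpoints : (F : List (Subset n)) → All (IsInterval n) F → ∃[ G ] map arc G ≡ F
endpoints []      []                      = [] , refl
endpoints (_ ∷ F) ((k , l , refl) ∷ F-intervals) with endpoints F F-intervals
... | G , refl = (k , l) ∷ G , refl

∪-⊆-∩ : {p q r s : Subset n} → p ⊆ r → p ⊆ s → q ⊆ r → q ⊆ s → p ∪ q ⊆ r ∩ s
∪-⊆-∩ {p = p} {q} p⊆r p⊆s q⊆r q⊆s i∈ =
  [ (λ i∈p → x∈p∩q⁺ (p⊆r i∈p , p⊆s i∈p)) , (λ i∈q → x∈p∩q⁺ (q⊆r i∈q , q⊆s i∈q)) ]′ (x∈p∪q⁻ p q i∈)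

lemma2 : (n : ℕ) → 2 ≤ n → (F : List (Subset n)) → Unique F →
    All (IsInterval n) F → ⊥ ∉ F → ⊤ ∉ F →
    (∀ A B C D → A ∈ F → B ∈ F → C ∈ F → D ∈ F →
      A ≢ B → A ≢ C → A ≢ D → B ≢ C → B ≢ D → C ≢ D →
      ¬ ((A ∪ B) ⊆ (C ∩ D))) →
    length F ≤ 2 * n
lemma2 n _ F F-unique F-intervals _ ⊤∉F no-butterfly with endpoints F F-intervals
... | G , refl = begin
  length (map arc G) ≡⟨ length-map arc G ⟩
  length G           ≤⟨ butterfly-free-length (intervalSystem n) G (map⁻ F-unique) G-butterfly-free ⟩
  2 * n              ∎
  where
  open ≤-Reasoning
  arc-injective : ∀ {p q} → p ∈ G → p ≢ q → arc p ≢ arc q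
  arc-injective p∈ p≢q eq =
    p≢q (×-≡,≡→≡ (interval-injective (λ ≡⊤ → ⊤∉F (subst (_∈ map arc G) ≡⊤ (∈-map⁺ arc p∈))) eq))
  G-butterfly-free : ButterflyFree (λ p q → arc p ⊆ arc q) G
  G-butterfly-free a∈ b∈ c∈ d∈ a≢b a≢c a≢d b≢c b≢d c≢d (a⊆c , a⊆d , b⊆c , b⊆d) =
    no-butterfly _ _ _ _ (∈-map⁺ arc a∈) (∈-map⁺ arc b∈) (∈-map⁺ arc c∈) (∈-map⁺ arc d∈)
      (arc-injective a∈ a≢b) (arc-injective a∈ a≢c) (arc-injective a∈ a≢d)
      (arc-injective b∈ b≢c) (arc-injective b∈ b≢d) (arc-injective c∈ c≢d)
      (∪-⊆-∩ a⊆c a⊆d b⊆c b⊆d)
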